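{- For every integer $m \geq 13$, the independence polynomial of the tree $(T_{1,7}^v:S_{2,5}^w)_2^{(m)}$ has degree $12m+8$, and its log-concavity is broken at indices $12m+7$, $12m+6$, and $12m+5$.
   Context: $I(G;x)=\sum_i s_ix^i$ with $s_i$ the number of independent sets of size $i$. Log-concavity of $I(G;x)$ is broken at index $i$ if $s_i^2 < s_{i-1}s_{i+1}$. For a rooted graph $H^w$ and $k\ge0$, $Z_k(H^w)$ is a new vertex $v_0$ joined to the roots of $k$ disjoint copies of $H$; $(G^v:H^w)_k$ is the disjoint union of $G$ and $Z_k(H^w)$ plus the edge $vv_0$, rooted at $v$; $(G^v:H^w)_k^{(m)}$ is obtained by applying this construction $m$ times, each time to the previous graph (still rooted at $v$). $P_t^w$ is the path on $t$ vertices rooted at a leaf. $T_{1,\ell}^v=(P_1^v:P_2^w)_\ell$: a root $v$ with one child carrying $\ell$ pendant 2-vertex paths. $S_{2,t}^w$ is the spider with $t$ legs of length 2 rooted at its center $w$ (equivalently $(P_1^w:P_1^w)_1^{(t)}$). -}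

module Defs where

open import Data.Nat using (ℕ; zero; suc; _+_; _*_; _∸_; _<_; _≡ᵇ_)
open import Data.Bool using (Bool; true; false; _∧_; not; if_then_else_)
open import Data.List using (List; []; _∷_; map; _++_; filter; length; concat; upTo)
open import Relation.Binary.PropositionalEquality using (_≡_; _≢_)
open import Data.Product using (_×_; _,_)
open import Function using (_∘_)
open import Relation.Nullary.Decidable using (does)
open import Data.Bool.Properties using () renaming (_≟_ to _≟ᵇ_)

-- A finite simple graph on vertex set {0, …, size-1}, given by its edge list
-- (edges are unordered: (a , b) means a—b).
record Graph : Set where
  constructor mkGraph
  field
    size  : ℕ
    edges : List (ℕ × ℕ)
open Graph public

record RGraph : Set where
  constructor mkRGraph
  field
    graph : Graph
    root  : ℕ
open RGraph public

shiftEdges : ℕ → List (ℕ × ℕ) → List (ℕ × ℕ)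
shiftEdges c = map (λ { (a , b) → (a + c , b + c) })

-- Z_k(H^w) placed inside a larger graph with v0 at index o and
-- the j-th copy of H occupying indices o+1+j*h, …, o+1+j*h+h-1.
copiesEdges : ℕ → RGraph → ℕ → List (ℕ × ℕ)
copiesEdges o H k =
  concat (map (λ j → let off = o + 1 + j * size (graph H) in
                     (o , off + root H) ∷ shiftEdges off (edges (graph H)))
              (upTo k))

-- (G^v : H^w)_k : disjoint union of G and Z_k(H^w) plus the edge v v0, rooted at v.
glue : RGraph → RGraph → ℕ → RGraph
glue G H k = mkRGraph
  (mkGraph (g + 1 + k * size (graph H))
           (edges (graph G) ++ ((root G , g) ∷ copiesEdges g H k)))
  (root G)
  where g = size (graph G)

glueIter : RGraph → RGraph → ℕ → ℕ → RGraph
glueIter G H k zero    = G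
glueIter G H k (suc m) = glue (glueIter G H k m) H k

P₁ : RGraph
P₁ = mkRGraph (mkGraph 1 []) 0

P₂ : RGraph
P₂ = mkRGraph (mkGraph 2 ((0 , 1) ∷ [])) 0

T₁ : ℕ → RGraph
T₁ ℓ = glue P₁ P₂ ℓ

S₂ : ℕ → RGraph
S₂ t = glueIter P₁ P₁ 1 t

-- subsets of {0,…,n-1} as characteristic lists of length n
allSubsets : ℕ → List (List Bool)
allSubsets zero    = [] ∷ []
allSubsets (suc n) = map (false ∷_) (allSubsets n) ++ map (true ∷_) (allSubsets n)

member : List Bool → ℕ → Bool
member []       _       = false
member (b ∷ _)  zero    = b
member (_ ∷ bs) (suc i) = member bs i

card : List Bool → ℕ
card []           = 0
card (true ∷ bs)  = suc (card bs)
card (false ∷ bs) = card bs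

allᵇ : {A : Set} → (A → Bool) → List A → Bool
allᵇ p []       = true
allᵇ p (x ∷ xs) = p x ∧ allᵇ p xs

countᵇ : {A : Set} → (A → Bool) → List A → ℕ
countᵇ p []       = 0
countᵇ p (x ∷ xs) = if p x then suc (countᵇ p xs) else countᵇ p xs

isIndependent : Graph → List Bool → Bool
isIndependent G S = allᵇ (λ { (a , b) → not (member S a ∧ member S b) }) (edges G)

indepCount : Graph → ℕ → ℕ
indepCount G i =
  countᵇ (λ S → isIndependent G S ∧ (card S ≡ᵇ i)) (allSubsets (size G))

LCBrokenAt : Graph → ℕ → Set
LCBrokenAt G i = indepCount G i * indepCount G i < indepCount G (i ∸ 1) * indepCount G (suc i)

HasDegree : Graph → ℕ → Set
HasDegree G d = (indepCount G d ≢ 0) × (∀ i → d < i → indepCount G i ≡ 0)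

{-# OPTIONS --safe #-}
-- Write O_m and I_m for the generating polynomials of the independent sets of the m-th tree that
-- avoid, respectively contain, its root v, and Z = Z₂(S₂,₅) with root v₀.  Splitting independent
-- sets along the bridge v v₀ gives O_{m+1} = O_m · I(Z) and I_{m+1} = I_m · O_v₀(Z), and both
-- factors are monic of degree 12.  So the five top coefficients (degrees 12m + 4, …, 12m + 8) are
-- moved by a fixed unipotent linear map at each step; hence they are fixed combinations of
-- C(m, 0), …, C(m, 4), which one induction confirms.  For m = 13 + n, 4! times these are
-- polynomials in n with natural coefficients, and for each of the three inequalities
-- s_i² < s_{i-1} s_{i+1} the polynomial on the right dominates the one on the left coefficientwise,
-- with a strictly larger constant term.

module Submission where

open import Defs
open import Data.Nat using (ℕ; zero; suc; _+_; _*_; _∸_; _≤_; _<_; z≤n; s≤s; _≡ᵇ_; _≤ᵇ_; _<ᵇ_; _!)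
open import Data.Nat.Properties
open import Data.Bool using (Bool; true; false; _∧_; not; T)
open import Data.Bool.Properties using (∧-assoc; ∧-zeroʳ; ∧-identityʳ; T-∧)
open import Data.List using (List; []; _∷_; _++_; map; length; concat; upTo; drop; zipWith; cartesianProductWith)
open import Data.List.Properties using (concat-++; map-++; map-∘; map-id; map-cong; drop-map; ++-identityʳ; upTo-∷ʳ; cartesianProductWith-distribʳ-++)
open import Data.List.Relation.Unary.All as All using (All; []; _∷_)
open import Data.List.Relation.Unary.All.Properties using (++⁺; map⁺)
open import Data.Product using (_×_; _,_; proj₁; proj₂)
open import Data.Vec as Vec using (Vec; _∷_; []; toList)
open import Data.Unit using (tt)
open import Function using (_∘_; Equivalence)
open import Relation.Binary.PropositionalEquality
open import Data.Nat.Tactic.RingSolver using (solve-∀)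
open import Algebra.Properties.CommutativeSemigroup +-commutativeSemigroup using () renaming (interchange to +-interchange)

open ≡-Reasoning

-- Coefficient lists and convolution

-- Coefficients listed from degree 0 up; _⊗_ multiplies by a polynomial with coefficients in ℕ.
module CoefficientLists {A : Set} (_+ᴬ_ : A → A → A) (_·_ : A → ℕ → A) (0ᴬ : A) where

  infixl 6 _⊕_
  infixl 7 _⊗_

  _⊕_ : List A → List A → List A
  []       ⊕ ys       = ys
  (x ∷ xs) ⊕ []       = x ∷ xs
  (x ∷ xs) ⊕ (y ∷ ys) = (x +ᴬ y) ∷ xs ⊕ ys

  _⊗_ : List A → List ℕ → List A
  xs ⊗ []      = []
  xs ⊗ (a ∷ q) = map (_· a) xs ⊕ (0ᴬ ∷ xs ⊗ q)

Poly : Set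
Poly = List ℕ

open CoefficientLists {ℕ} _+_ _*_ 0

coeff : Poly → ℕ → ℕ
coeff []      _       = 0
coeff (a ∷ p) zero    = a
coeff (a ∷ p) (suc i) = coeff p i

eval : Poly → ℕ → ℕ
eval []      x = 0
eval (a ∷ p) x = a + x * eval p x

_⋆_ : (ℕ → ℕ) → (ℕ → ℕ) → ℕ → ℕ
(f ⋆ g) zero    = f zero * g zero
(f ⋆ g) (suc i) = f (suc i) * g zero + (f ⋆ (g ∘ suc)) i

⋆-congˡ : ∀ {f f′} → f ≗ f′ → ∀ g → (f ⋆ g) ≗ (f′ ⋆ g)
⋆-congˡ f≗f′ g zero    = cong (_* g zero) (f≗f′ zero)
⋆-congˡ f≗f′ g (suc i) = cong₂ _+_ (cong (_* g zero) (f≗f′ (suc i))) (⋆-congˡ f≗f′ (g ∘ suc) i)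

⋆-congʳ : ∀ f {g g′} → g ≗ g′ → (f ⋆ g) ≗ (f ⋆ g′)
⋆-congʳ f g≗g′ zero    = cong (f zero *_) (g≗g′ zero)
⋆-congʳ f g≗g′ (suc i) = cong₂ _+_ (cong (f (suc i) *_) (g≗g′ zero)) (⋆-congʳ f (g≗g′ ∘ suc) i)

⋆-zeroʳ : ∀ f i → (f ⋆ λ _ → 0) i ≡ 0
⋆-zeroʳ f zero    = *-zeroʳ (f zero)
⋆-zeroʳ f (suc i) = cong₂ _+_ (*-zeroʳ (f (suc i))) (⋆-zeroʳ f i)

⋆-zeroˡ : ∀ g i → ((λ _ → 0) ⋆ g) i ≡ 0
⋆-zeroˡ g zero    = refl
⋆-zeroˡ g (suc i) = ⋆-zeroˡ (g ∘ suc) i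

⋆-distribʳ : ∀ f f′ g i → ((λ j → f j + f′ j) ⋆ g) i ≡ (f ⋆ g) i + (f′ ⋆ g) i
⋆-distribʳ f f′ g zero    = *-distribʳ-+ (g zero) (f zero) (f′ zero)
⋆-distribʳ f f′ g (suc i) = begin
  (f (suc i) + f′ (suc i)) * g 0 + ((λ j → f j + f′ j) ⋆ (g ∘ suc)) i
    ≡⟨ cong ((f (suc i) + f′ (suc i)) * g 0 +_) (⋆-distribʳ f f′ (g ∘ suc) i) ⟩
  (f (suc i) + f′ (suc i)) * g 0 + ((f ⋆ (g ∘ suc)) i + (f′ ⋆ (g ∘ suc)) i)
    ≡⟨ lemma (f (suc i)) (f′ (suc i)) (g 0) _ _ ⟩
  (f (suc i) * g 0 + (f ⋆ (g ∘ suc)) i) + (f′ (suc i) * g 0 + (f′ ⋆ (g ∘ suc)) i) ∎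
  where
  lemma : ∀ a b c d e → (a + b) * c + (d + e) ≡ (a * c + d) + (b * c + e)
  lemma = solve-∀

coeff-⊕ : ∀ p q i → coeff (p ⊕ q) i ≡ coeff p i + coeff q i
coeff-⊕ []      q       i       = refl
coeff-⊕ (a ∷ p) []      i       = sym (+-identityʳ _)
coeff-⊕ (a ∷ p) (b ∷ q) zero    = refl
coeff-⊕ (a ∷ p) (b ∷ q) (suc i) = coeff-⊕ p q i

coeff-scale : ∀ a p i → coeff (map (_* a) p) i ≡ coeff p i * a
coeff-scale a []      i       = refl
coeff-scale a (b ∷ p) zero    = refl
coeff-scale a (b ∷ p) (suc i) = coeff-scale a p i

coeff-⊗ : ∀ p q → coeff (p ⊗ q) ≗ (coeff p ⋆ coeff q)
coeff-⊗ p []      i       = sym (⋆-zeroʳ (coeff p) i)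
coeff-⊗ p (a ∷ q) zero    = begin
  coeff (map (_* a) p ⊕ (0 ∷ p ⊗ q)) 0  ≡⟨ coeff-⊕ (map (_* a) p) _ 0 ⟩
  coeff (map (_* a) p) 0 + 0            ≡⟨ +-identityʳ _ ⟩
  coeff (map (_* a) p) 0                ≡⟨ coeff-scale a p 0 ⟩
  coeff p 0 * a                         ∎
coeff-⊗ p (a ∷ q) (suc i) = begin
  coeff (map (_* a) p ⊕ (0 ∷ p ⊗ q)) (suc i)      ≡⟨ coeff-⊕ (map (_* a) p) _ (suc i) ⟩
  coeff (map (_* a) p) (suc i) + coeff (p ⊗ q) i  ≡⟨ cong₂ _+_ (coeff-scale a p (suc i)) (coeff-⊗ p q i) ⟩
  coeff p (suc i) * a + (coeff p ⋆ coeff q) i     ∎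

coeff-drop : ∀ d p i → coeff p (d + i) ≡ coeff (drop d p) i
coeff-drop zero    p       i = refl
coeff-drop (suc d) []      i = refl
coeff-drop (suc d) (a ∷ p) i = coeff-drop d p i

eval-⊕ : ∀ p q x → eval (p ⊕ q) x ≡ eval p x + eval q x
eval-⊕ []      q       x = refl
eval-⊕ (a ∷ p) []      x = sym (+-identityʳ _)
eval-⊕ (a ∷ p) (b ∷ q) x = begin
  a + b + x * eval (p ⊕ q) x              ≡⟨ cong (λ e → a + b + x * e) (eval-⊕ p q x) ⟩
  a + b + x * (eval p x + eval q x)       ≡⟨ lemma a b x (eval p x) (eval q x) ⟩
  (a + x * eval p x) + (b + x * eval q x) ∎
  where
  lemma : ∀ a b x u v → a + b + x * (u + v) ≡ (a + x * u) + (b + x * v)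
  lemma = solve-∀

eval-scale : ∀ a p x → eval (map (_* a) p) x ≡ eval p x * a
eval-scale a []      x = refl
eval-scale a (b ∷ p) x = begin
  b * a + x * eval (map (_* a) p) x ≡⟨ cong (λ e → b * a + x * e) (eval-scale a p x) ⟩
  b * a + x * (eval p x * a)        ≡⟨ lemma a b x (eval p x) ⟩
  (b + x * eval p x) * a            ∎
  where
  lemma : ∀ a b x u → b * a + x * (u * a) ≡ (b + x * u) * a
  lemma = solve-∀

eval-⊗ : ∀ p q x → eval (p ⊗ q) x ≡ eval p x * eval q x
eval-⊗ p []      x = sym (*-zeroʳ (eval p x))
eval-⊗ p (a ∷ q) x = begin
  eval (map (_* a) p ⊕ (0 ∷ p ⊗ q)) x      ≡⟨ eval-⊕ (map (_* a) p) _ x ⟩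
  eval (map (_* a) p) x + x * eval (p ⊗ q) x ≡⟨ cong₂ (λ u v → u + x * v) (eval-scale a p x) (eval-⊗ p q x) ⟩
  eval p x * a + x * (eval p x * eval q x)   ≡⟨ lemma a x (eval p x) (eval q x) ⟩
  eval p x * (a + x * eval q x)              ∎
  where
  lemma : ∀ a x u v → u * a + x * (u * v) ≡ u * (a + x * v)
  lemma = solve-∀

-- Counting subsets by size

𝟙 : Bool → ℕ
𝟙 true  = 1
𝟙 false = 0

δ : ℕ → ℕ → ℕ
δ c j = 𝟙 (c ≡ᵇ j)

timesXPow : ℕ → (ℕ → ℕ) → ℕ → ℕ
timesXPow zero    g i       = g i
timesXPow (suc c) g zero    = 0
timesXPow (suc c) g (suc i) = timesXPow c g i

timesXPow-peel : ∀ c g i → timesXPow c g i ≡ δ c i * g 0 + timesXPow (suc c) (g ∘ suc) i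
timesXPow-peel zero    g zero    = sym (trans (+-identityʳ _) (*-identityˡ _))
timesXPow-peel zero    g (suc i) = refl
timesXPow-peel (suc c) g zero    = refl
timesXPow-peel (suc c) g (suc i) = timesXPow-peel c g i

δ-⋆ : ∀ c g i → (δ c ⋆ g) i ≡ timesXPow c g i
δ-⋆ zero    g zero    = *-identityˡ _
δ-⋆ (suc c) g zero    = refl
δ-⋆ c       g (suc i) = begin
  δ c (suc i) * g 0 + (δ c ⋆ (g ∘ suc)) i      ≡⟨ cong (δ c (suc i) * g 0 +_) (δ-⋆ c (g ∘ suc) i) ⟩
  δ c (suc i) * g 0 + timesXPow c (g ∘ suc) i  ≡⟨ timesXPow-peel c g (suc i) ⟨
  timesXPow c g (suc i)                        ∎

countᵇ-∷ : ∀ {A : Set} (p : A → Bool) x xs → countᵇ p (x ∷ xs) ≡ 𝟙 (p x) + countᵇ p xs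
countᵇ-∷ p x xs with p x
... | true  = refl
... | false = refl

countᵇ-cong : ∀ {A : Set} {p q : A → Bool} → p ≗ q → ∀ xs → countᵇ p xs ≡ countᵇ q xs
countᵇ-cong p≗q []       = refl
countᵇ-cong {p = p} {q} p≗q (x ∷ xs) = begin
  countᵇ p (x ∷ xs)          ≡⟨ countᵇ-∷ p x xs ⟩
  𝟙 (p x) + countᵇ p xs      ≡⟨ cong₂ _+_ (cong 𝟙 (p≗q x)) (countᵇ-cong p≗q xs) ⟩
  𝟙 (q x) + countᵇ q xs      ≡⟨ countᵇ-∷ q x xs ⟨
  countᵇ q (x ∷ xs)          ∎

countᵇ-none : ∀ {A : Set} {p : A → Bool} → (∀ x → p x ≡ false) → ∀ xs → countᵇ p xs ≡ 0
countᵇ-none none []       = refl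
countᵇ-none {p = p} none (x ∷ xs) = trans (countᵇ-∷ p x xs) (cong₂ _+_ (cong 𝟙 (none x)) (countᵇ-none none xs))

countᵇ-++ : ∀ {A : Set} (p : A → Bool) xs ys → countᵇ p (xs ++ ys) ≡ countᵇ p xs + countᵇ p ys
countᵇ-++ p []       ys = refl
countᵇ-++ p (x ∷ xs) ys = begin
  countᵇ p (x ∷ xs ++ ys)              ≡⟨ countᵇ-∷ p x (xs ++ ys) ⟩
  𝟙 (p x) + countᵇ p (xs ++ ys)        ≡⟨ cong (𝟙 (p x) +_) (countᵇ-++ p xs ys) ⟩
  𝟙 (p x) + (countᵇ p xs + countᵇ p ys) ≡⟨ +-assoc (𝟙 (p x)) _ _ ⟨
  (𝟙 (p x) + countᵇ p xs) + countᵇ p ys ≡⟨ cong (_+ countᵇ p ys) (countᵇ-∷ p x xs) ⟨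
  countᵇ p (x ∷ xs) + countᵇ p ys      ∎

countᵇ-map : ∀ {A B : Set} (p : B → Bool) (f : A → B) xs → countᵇ p (map f xs) ≡ countᵇ (p ∘ f) xs
countᵇ-map p f []       = refl
countᵇ-map p f (x ∷ xs) rewrite countᵇ-map p f xs = refl

countᵇ-∧ˡ : ∀ {A : Set} b (q : A → Bool) xs → countᵇ (λ x → b ∧ q x) xs ≡ 𝟙 b * countᵇ q xs
countᵇ-∧ˡ true  q xs = sym (*-identityˡ _)
countᵇ-∧ˡ false q xs = countᵇ-none (λ _ → refl) xs

countBySize : (List Bool → Bool) → List (List Bool) → ℕ → ℕ
countBySize p Ss i = countᵇ (λ S → p S ∧ (card S ≡ᵇ i)) Ss

countBySize-split : ∀ (p q : List Bool → Bool) Ss i →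
  countBySize p Ss i ≡ countBySize (λ S → p S ∧ not (q S)) Ss i + countBySize (λ S → p S ∧ q S) Ss i
countBySize-split p q []       i = refl
countBySize-split p q (S ∷ Ss) i = begin
  countBySize p (S ∷ Ss) i
    ≡⟨ countᵇ-∷ (λ S → p S ∧ (card S ≡ᵇ i)) S Ss ⟩
  𝟙 (p S ∧ sized) + countBySize p Ss i
    ≡⟨ cong₂ _+_ (𝟙-split (p S) (q S) sized) (countBySize-split p q Ss i) ⟩
  (𝟙 (p⁻ S ∧ sized) + 𝟙 (p⁺ S ∧ sized)) + (countBySize p⁻ Ss i + countBySize p⁺ Ss i)
    ≡⟨ +-interchange (𝟙 (p⁻ S ∧ sized)) _ _ _ ⟩
  (𝟙 (p⁻ S ∧ sized) + countBySize p⁻ Ss i) + (𝟙 (p⁺ S ∧ sized) + countBySize p⁺ Ss i)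
    ≡⟨ cong₂ _+_ (countᵇ-∷ (λ S → p⁻ S ∧ (card S ≡ᵇ i)) S Ss) (countᵇ-∷ (λ S → p⁺ S ∧ (card S ≡ᵇ i)) S Ss) ⟨
  countBySize p⁻ (S ∷ Ss) i + countBySize p⁺ (S ∷ Ss) i ∎
  where
  sized : Bool
  sized = card S ≡ᵇ i
  p⁻ p⁺ : List Bool → Bool
  p⁻ S = p S ∧ not (q S)
  p⁺ S = p S ∧ q S
  𝟙-split : ∀ x y z → 𝟙 (x ∧ z) ≡ 𝟙 ((x ∧ not y) ∧ z) + 𝟙 ((x ∧ y) ∧ z)
  𝟙-split true  true  z     = refl
  𝟙-split true  false true  = refl
  𝟙-split true  false false = refl
  𝟙-split false y     z     = refl

card-++ : ∀ S T → card (S ++ T) ≡ card S + card T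
card-++ []          T = refl
card-++ (true ∷ S)  T = cong suc (card-++ S T)
card-++ (false ∷ S) T = card-++ S T

countBySize-timesXPow : ∀ c q Ts i →
  countᵇ (λ T → q T ∧ (c + card T ≡ᵇ i)) Ts ≡ timesXPow c (countBySize q Ts) i
countBySize-timesXPow zero    q Ts i       = refl
countBySize-timesXPow (suc c) q Ts zero    = countᵇ-none (λ T → ∧-zeroʳ (q T)) Ts
countBySize-timesXPow (suc c) q Ts (suc i) = countBySize-timesXPow c q Ts i

countBySize-cartesianProduct : ∀ (P p q : List Bool → Bool) Ss Ts →
  All (λ S → ∀ T → P (S ++ T) ≡ p S ∧ q T) Ss →
  countBySize P (cartesianProductWith _++_ Ss Ts) ≗ (countBySize p Ss ⋆ countBySize q Ts)
countBySize-cartesianProduct P p q []       Ts []             i = sym (⋆-zeroˡ _ i)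
countBySize-cartesianProduct P p q (S ∷ Ss) Ts (factor ∷ fs) i = begin
  countBySize P (map (S ++_) Ts ++ cartesianProductWith _++_ Ss Ts) i
    ≡⟨ countᵇ-++ _ (map (S ++_) Ts) _ ⟩
  countBySize P (map (S ++_) Ts) i + countBySize P (cartesianProductWith _++_ Ss Ts) i
    ≡⟨ cong₂ _+_ prefixed (countBySize-cartesianProduct P p q Ss Ts fs i) ⟩
  𝟙 (p S) * (δ (card S) ⋆ g) i + (countBySize p Ss ⋆ g) i
    ≡⟨ cong (_+ (countBySize p Ss ⋆ g) i) (scaleˡ (p S)) ⟩
  ((λ j → 𝟙 (p S ∧ (card S ≡ᵇ j))) ⋆ g) i + (countBySize p Ss ⋆ g) i
    ≡⟨ ⋆-distribʳ _ (countBySize p Ss) g i ⟨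
  ((λ j → 𝟙 (p S ∧ (card S ≡ᵇ j)) + countBySize p Ss j) ⋆ g) i
    ≡⟨ ⋆-congˡ (λ j → countᵇ-∷ _ S Ss) g i ⟨
  (countBySize p (S ∷ Ss) ⋆ g) i ∎
  where
  g = countBySize q Ts
  prefixed : countBySize P (map (S ++_) Ts) i ≡ 𝟙 (p S) * (δ (card S) ⋆ g) i
  prefixed = begin
    countBySize P (map (S ++_) Ts) i
      ≡⟨ countᵇ-map _ (S ++_) Ts ⟩
    countᵇ (λ T → P (S ++ T) ∧ (card (S ++ T) ≡ᵇ i)) Ts
      ≡⟨ countᵇ-cong (λ T → trans (cong₂ _∧_ (factor T) (cong (_≡ᵇ i) (card-++ S T))) (∧-assoc (p S) (q T) _)) Ts ⟩
    countᵇ (λ T → p S ∧ (q T ∧ (card S + card T ≡ᵇ i))) Ts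
      ≡⟨ countᵇ-∧ˡ (p S) _ Ts ⟩
    𝟙 (p S) * countᵇ (λ T → q T ∧ (card S + card T ≡ᵇ i)) Ts
      ≡⟨ cong (𝟙 (p S) *_) (trans (countBySize-timesXPow (card S) q Ts i) (sym (δ-⋆ (card S) g i))) ⟩
    𝟙 (p S) * (δ (card S) ⋆ g) i ∎
  scaleˡ : ∀ b → 𝟙 b * (δ (card S) ⋆ g) i ≡ ((λ j → 𝟙 (b ∧ (card S ≡ᵇ j))) ⋆ g) i
  scaleˡ true  = +-identityʳ _
  scaleˡ false = sym (⋆-zeroˡ g i)

cartesianProductWith-map-∷ : ∀ b (Ss Ts : List (List Bool)) →
  cartesianProductWith _++_ (map (b ∷_) Ss) Ts ≡ map (b ∷_) (cartesianProductWith _++_ Ss Ts)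
cartesianProductWith-map-∷ b []       Ts = refl
cartesianProductWith-map-∷ b (S ∷ Ss) Ts = begin
  map ((b ∷ S) ++_) Ts ++ cartesianProductWith _++_ (map (b ∷_) Ss) Ts
    ≡⟨ cong₂ _++_ (map-∘ Ts) (cartesianProductWith-map-∷ b Ss Ts) ⟩
  map (b ∷_) (map (S ++_) Ts) ++ map (b ∷_) (cartesianProductWith _++_ Ss Ts)
    ≡⟨ map-++ (b ∷_) (map (S ++_) Ts) _ ⟨
  map (b ∷_) (map (S ++_) Ts ++ cartesianProductWith _++_ Ss Ts) ∎

allSubsets-+ : ∀ g n → allSubsets (g + n) ≡ cartesianProductWith _++_ (allSubsets g) (allSubsets n)
allSubsets-+ zero    n = sym (trans (++-identityʳ _) (map-id _))
allSubsets-+ (suc g) n = begin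
  map (false ∷_) (allSubsets (g + n)) ++ map (true ∷_) (allSubsets (g + n))
    ≡⟨ cong (λ Us → map (false ∷_) Us ++ map (true ∷_) Us) (allSubsets-+ g n) ⟩
  map (false ∷_) (cartesianProductWith _++_ Ss Ts) ++ map (true ∷_) (cartesianProductWith _++_ Ss Ts)
    ≡⟨ cong₂ _++_ (cartesianProductWith-map-∷ false Ss Ts) (cartesianProductWith-map-∷ true Ss Ts) ⟨
  cartesianProductWith _++_ (map (false ∷_) Ss) Ts ++ cartesianProductWith _++_ (map (true ∷_) Ss) Ts
    ≡⟨ cartesianProductWith-distribʳ-++ _++_ (map (false ∷_) Ss) _ Ts ⟨
  cartesianProductWith _++_ (allSubsets (suc g)) Ts ∎
  where
  Ss = allSubsets g
  Ts = allSubsets n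

allSubsets-length : ∀ g → All (λ S → length S ≡ g) (allSubsets g)
allSubsets-length zero    = refl ∷ []
allSubsets-length (suc g) = ++⁺ (map⁺ (All.map (cong suc) (allSubsets-length g))) (map⁺ (All.map (cong suc) (allSubsets-length g)))

-- Independent sets across a bridge

-- isIndependent G is definitionally independent (edges G).
independent : List (ℕ × ℕ) → List Bool → Bool
independent E S = allᵇ (λ e → not (member S (proj₁ e) ∧ member S (proj₂ e))) E

EdgesWithin : ℕ → List (ℕ × ℕ) → Set
EdgesWithin n = All (λ e → proj₁ e < n × proj₂ e < n)

allᵇ-++ : ∀ {A : Set} (p : A → Bool) xs ys → allᵇ p (xs ++ ys) ≡ allᵇ p xs ∧ allᵇ p ys
allᵇ-++ p []       ys = refl
allᵇ-++ p (x ∷ xs) ys = trans (cong (p x ∧_) (allᵇ-++ p xs ys)) (sym (∧-assoc (p x) _ _))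

member-++ˡ : ∀ S T {x} → x < length S → member (S ++ T) x ≡ member S x
member-++ˡ (b ∷ S) T {zero}  _         = refl
member-++ˡ (b ∷ S) T {suc x} (s≤s x<n) = member-++ˡ S T x<n

member-++ʳ : ∀ S T x → member (S ++ T) (x + length S) ≡ member T x
member-++ʳ []      T x = cong (member T) (+-identityʳ x)
member-++ʳ (b ∷ S) T x = trans (cong (member (b ∷ S ++ T)) (+-suc x (length S))) (member-++ʳ S T x)

independent-++ˡ : ∀ S T {E} → EdgesWithin (length S) E → independent E (S ++ T) ≡ independent E S
independent-++ˡ S T []                  = refl
independent-++ˡ S T ((a<n , b<n) ∷ within) =
  cong₂ _∧_ (cong₂ (λ x y → not (x ∧ y)) (member-++ˡ S T a<n) (member-++ˡ S T b<n)) (independent-++ˡ S T within)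

independent-++ʳ : ∀ S T E → independent (shiftEdges (length S) E) (S ++ T) ≡ independent E T
independent-++ʳ S T []      = refl
independent-++ʳ S T (e ∷ E) =
  cong₂ _∧_ (cong₂ (λ x y → not (x ∧ y)) (member-++ʳ S T (proj₁ e)) (member-++ʳ S T (proj₂ e))) (independent-++ʳ S T E)

bridge : Graph → ℕ → Graph → ℕ → Graph
bridge G a H b = mkGraph (size G + size H) (edges G ++ (a , size G + b) ∷ shiftEdges (size G) (edges H))

independent-bridge : ∀ S T {E₁ E₂ a b} → EdgesWithin (length S) E₁ → a < length S →
  independent (E₁ ++ (a , length S + b) ∷ shiftEdges (length S) E₂) (S ++ T)
    ≡ independent E₁ S ∧ (not (member S a ∧ member T b) ∧ independent E₂ T)
independent-bridge S T {E₁} {E₂} {a} {b} within a<n = begin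
  independent (E₁ ++ (a , length S + b) ∷ shiftEdges (length S) E₂) (S ++ T)
    ≡⟨ allᵇ-++ _ E₁ _ ⟩
  independent E₁ (S ++ T) ∧ (not (member (S ++ T) a ∧ member (S ++ T) (length S + b)) ∧ independent (shiftEdges (length S) E₂) (S ++ T))
    ≡⟨ cong₂ _∧_ (independent-++ˡ S T within)
         (cong₂ _∧_ (cong₂ (λ x y → not (x ∧ y)) (member-++ˡ S T a<n) (trans (cong (member (S ++ T)) (+-comm (length S) b)) (member-++ʳ S T b)))
                    (independent-++ʳ S T E₂)) ⟩
  independent E₁ S ∧ (not (member S a ∧ member T b) ∧ independent E₂ T) ∎

bridge-without-factor : ∀ {g E₁ E₂ a b} S T → length S ≡ g → EdgesWithin g E₁ → a < g →
  (independent (E₁ ++ (a , g + b) ∷ shiftEdges g E₂) (S ++ T) ∧ not (member (S ++ T) a))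
    ≡ (independent E₁ S ∧ not (member S a)) ∧ independent E₂ T
bridge-without-factor {E₁ = E₁} {E₂} {a} {b} S T refl within a<g =
  trans (cong₂ _∧_ (independent-bridge S T within a<g) (cong not (member-++ˡ S T a<g)))
        (boolean (independent E₁ S) (member S a) (member T b) (independent E₂ T))
  where
  boolean : ∀ x y z w → (x ∧ (not (y ∧ z) ∧ w)) ∧ not y ≡ (x ∧ not y) ∧ w
  boolean true  true  z w = ∧-zeroʳ _
  boolean true  false z w = ∧-identityʳ w
  boolean false y     z w = refl

bridge-with-factor : ∀ {g E₁ E₂ a b} S T → length S ≡ g → EdgesWithin g E₁ → a < g →
  (independent (E₁ ++ (a , g + b) ∷ shiftEdges g E₂) (S ++ T) ∧ member (S ++ T) a)
    ≡ (independent E₁ S ∧ member S a) ∧ (independent E₂ T ∧ not (member T b))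
bridge-with-factor {E₁ = E₁} {E₂} {a} {b} S T refl within a<g =
  trans (cong₂ _∧_ (independent-bridge S T within a<g) (member-++ˡ S T a<g))
        (boolean (independent E₁ S) (member S a) (member T b) (independent E₂ T))
  where
  boolean : ∀ x y z w → (x ∧ (not (y ∧ z) ∧ w)) ∧ y ≡ (x ∧ y) ∧ (w ∧ not z)
  boolean true  true  true  w     = sym (∧-zeroʳ w)
  boolean true  true  false true  = refl
  boolean true  true  false false = refl
  boolean true  false z     w     = ∧-zeroʳ _
  boolean false y     z     w     = refl

countWithout countWith : Graph → ℕ → ℕ → ℕ
countWithout G r = countBySize (λ S → isIndependent G S ∧ not (member S r)) (allSubsets (size G))
countWith    G r = countBySize (λ S → isIndependent G S ∧ member S r) (allSubsets (size G))

indepCount-split : ∀ G r i → indepCount G i ≡ countWithout G r i + countWith G r i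
indepCount-split G r = countBySize-split (isIndependent G) (λ S → member S r) (allSubsets (size G))

ValidEdges : Graph → Set
ValidEdges G = EdgesWithin (size G) (edges G)

module _ (G H : Graph) {a b : ℕ} (valid : ValidEdges G) (a<g : a < size G) where

  countWithout-bridge : countWithout (bridge G a H b) a ≗ (countWithout G a ⋆ indepCount H)
  countWithout-bridge i = begin
    countBySize P (allSubsets (size G + size H)) i
      ≡⟨ cong (λ Us → countBySize P Us i) (allSubsets-+ (size G) (size H)) ⟩
    countBySize P (cartesianProductWith _++_ (allSubsets (size G)) (allSubsets (size H))) i
      ≡⟨ countBySize-cartesianProduct P _ (isIndependent H) _ _ (All.map (λ {S} |S|≡g T → bridge-without-factor S T |S|≡g valid a<g) (allSubsets-length (size G))) i ⟩
    (countWithout G a ⋆ indepCount H) i ∎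
    where
    P : List Bool → Bool
    P S = isIndependent (bridge G a H b) S ∧ not (member S a)

  countWith-bridge : countWith (bridge G a H b) a ≗ (countWith G a ⋆ countWithout H b)
  countWith-bridge i = begin
    countBySize P (allSubsets (size G + size H)) i
      ≡⟨ cong (λ Us → countBySize P Us i) (allSubsets-+ (size G) (size H)) ⟩
    countBySize P (cartesianProductWith _++_ (allSubsets (size G)) (allSubsets (size H))) i
      ≡⟨ countBySize-cartesianProduct P _ (λ T → isIndependent H T ∧ not (member T b)) _ _ (All.map (λ {S} |S|≡g T → bridge-with-factor S T |S|≡g valid a<g) (allSubsets-length (size G))) i ⟩
    (countWith G a ⋆ countWithout H b) i ∎
    where
    P : List Bool → Bool
    P S = isIndependent (bridge G a H b) S ∧ member S a

-- Gluing

Z : RGraph → ℕ → RGraph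
Z H k = mkRGraph (mkGraph (1 + k * size (graph H)) (copiesEdges 0 H k)) 0

copyEdges : ℕ → RGraph → ℕ → List (ℕ × ℕ)
copyEdges o H j = (o , (o + 1 + j * size (graph H)) + root H) ∷ shiftEdges (o + 1 + j * size (graph H)) (edges (graph H))

shiftEdges-+ : ∀ p q E → shiftEdges (q + p) E ≡ shiftEdges p (shiftEdges q E)
shiftEdges-+ p q []      = refl
shiftEdges-+ p q (e ∷ E) = cong₂ _∷_ (cong₂ _,_ (sym (+-assoc (proj₁ e) q p)) (sym (+-assoc (proj₂ e) q p))) (shiftEdges-+ p q E)

copyEdges-shift : ∀ o H j → copyEdges o H j ≡ shiftEdges o (copyEdges 0 H j)
copyEdges-shift o H j = cong₂ _∷_
  (cong (o ,_) (root-offset o y (root H)))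
  (trans (cong (λ s → shiftEdges s (edges (graph H))) (offset o y)) (shiftEdges-+ o (suc y) _))
  where
  y = j * size (graph H)
  root-offset : ∀ o y r → o + 1 + y + r ≡ suc (y + r) + o
  root-offset = solve-∀
  offset : ∀ o y → o + 1 + y ≡ suc y + o
  offset = solve-∀

copiesEdges-shift : ∀ o H k → copiesEdges o H k ≡ shiftEdges o (copiesEdges 0 H k)
copiesEdges-shift o H k = go (upTo k)
  where
  go : ∀ js → concat (map (copyEdges o H) js) ≡ shiftEdges o (concat (map (copyEdges 0 H) js))
  go []       = refl
  go (j ∷ js) = trans (cong₂ _++_ (copyEdges-shift o H j) (go js)) (sym (map-++ _ (copyEdges 0 H j) _))

copiesEdges-suc : ∀ H k → copiesEdges 0 H (suc k) ≡ copiesEdges 0 H k ++ copyEdges 0 H k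
copiesEdges-suc H k = begin
  concat (map (copyEdges 0 H) (upTo (suc k)))          ≡⟨ cong (concat ∘ map (copyEdges 0 H)) (upTo-∷ʳ k) ⟨
  concat (map (copyEdges 0 H) (upTo k ++ k ∷ []))      ≡⟨ cong concat (map-++ (copyEdges 0 H) (upTo k) _) ⟩
  concat (map (copyEdges 0 H) (upTo k) ++ copyEdges 0 H k ∷ []) ≡⟨ concat-++ (map (copyEdges 0 H) (upTo k)) _ ⟨
  copiesEdges 0 H k ++ copyEdges 0 H k ++ []           ≡⟨ cong (copiesEdges 0 H k ++_) (++-identityʳ _) ⟩
  copiesEdges 0 H k ++ copyEdges 0 H k                 ∎

glue-bridge : ∀ G H k → graph (glue G H k) ≡ bridge (graph G) (root G) (graph (Z H k)) 0
glue-bridge G H k = cong₂ mkGraph (+-assoc g 1 _)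
  (cong (edges (graph G) ++_) (cong₂ _∷_ (cong (root G ,_) (sym (+-identityʳ g))) (copiesEdges-shift g H k)))
  where g = size (graph G)

Z-suc-bridge : ∀ H k → graph (Z H (suc k)) ≡ bridge (graph (Z H k)) 0 (graph H) (root H)
Z-suc-bridge H k = cong₂ mkGraph (cong suc (+-comm (size (graph H)) _)) (copiesEdges-suc H k)

EdgesWithin-mono : ∀ {m n} E → m ≤ n → EdgesWithin m E → EdgesWithin n E
EdgesWithin-mono E m≤n = All.map (λ (x<m , y<m) → <-≤-trans x<m m≤n , <-≤-trans y<m m≤n)

EdgesWithin-shift : ∀ {n} o E → EdgesWithin n E → EdgesWithin (o + n) (shiftEdges o E)
EdgesWithin-shift o []      []                   = []
EdgesWithin-shift o (e ∷ E) ((x<n , y<n) ∷ within) =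
  (shifted x<n , shifted y<n) ∷ EdgesWithin-shift o E within
  where
  shifted : ∀ {x n} → x < n → x + o < o + n
  shifted {x} {n} x<n = subst (_< o + n) (+-comm o x) (+-monoʳ-< o x<n)

bridge-valid : ∀ G H {a b} → ValidEdges G → a < size G → ValidEdges H → b < size H → ValidEdges (bridge G a H b)
bridge-valid G H validG a<g validH b<h =
  ++⁺ (EdgesWithin-mono (edges G) (m≤m+n _ _) validG)
      ((<-≤-trans a<g (m≤m+n _ _) , +-monoʳ-< (size G) b<h) ∷ EdgesWithin-shift (size G) (edges H) validH)

WellFormed : RGraph → Set
WellFormed R = ValidEdges (graph R) × root R < size (graph R)

Z-valid : ∀ H k → WellFormed H → ValidEdges (graph (Z H k))
Z-valid H zero    wf             = []
Z-valid H (suc k) (validH , r<h) =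
  subst ValidEdges (sym (Z-suc-bridge H k)) (bridge-valid (graph (Z H k)) (graph H) (Z-valid H k (validH , r<h)) (s≤s z≤n) validH r<h)

glue-wellFormed : ∀ G H k → WellFormed G → WellFormed H → WellFormed (glue G H k)
glue-wellFormed G H k (validG , r<g) wfH =
  subst ValidEdges (sym (glue-bridge G H k)) (bridge-valid (graph G) (graph (Z H k)) validG r<g (Z-valid H k wfH) (s≤s z≤n)) ,
  <-≤-trans r<g (≤-trans (m≤m+n _ 1) (m≤m+n _ _))

glueIter-wellFormed : ∀ G H k m → WellFormed G → WellFormed H → WellFormed (glueIter G H k m)
glueIter-wellFormed G H k zero    wfG wfH = wfG
glueIter-wellFormed G H k (suc m) wfG wfH = glue-wellFormed (glueIter G H k m) H k (glueIter-wellFormed G H k m wfG wfH) wfH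

HasRootPolys : Graph → ℕ → Poly × Poly → Set
HasRootPolys G r (o , i) = (countWithout G r ≗ coeff o) × (countWith G r ≗ coeff i)

total : Poly × Poly → Poly
total (o , i) = o ⊕ i

indepCount-total : ∀ {G r} p → HasRootPolys G r p → indepCount G ≗ coeff (total p)
indepCount-total {G} {r} (o , i) (without , with′) j = begin
  indepCount G j                          ≡⟨ indepCount-split G r j ⟩
  countWithout G r j + countWith G r j    ≡⟨ cong₂ _+_ (without j) (with′ j) ⟩
  coeff o j + coeff i j                   ≡⟨ coeff-⊕ o i j ⟨
  coeff (o ⊕ i) j                         ∎

bridgePolys : Poly × Poly → Poly × Poly → Poly × Poly
bridgePolys (o , i) h = (o ⊗ total h , i ⊗ proj₁ h)

bridge-rootPolys : ∀ G H {a b} g h → ValidEdges G → a < size G →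
  HasRootPolys G a g → HasRootPolys H b h → HasRootPolys (bridge G a H b) a (bridgePolys g h)
bridge-rootPolys G H {a} {b} (o , i) h valid a<g (withoutG , withG) (withoutH , withH) =
  (λ j → begin
    countWithout (bridge G a H b) a j           ≡⟨ countWithout-bridge G H valid a<g j ⟩
    (countWithout G a ⋆ indepCount H) j         ≡⟨ ⋆-congˡ withoutG _ j ⟩
    (coeff o ⋆ indepCount H) j                  ≡⟨ ⋆-congʳ (coeff o) (indepCount-total {H} {b} h (withoutH , withH)) j ⟩
    (coeff o ⋆ coeff (total h)) j               ≡⟨ coeff-⊗ o (total h) j ⟨
    coeff (o ⊗ total h) j                       ∎) ,
  (λ j → begin
    countWith (bridge G a H b) a j              ≡⟨ countWith-bridge G H valid a<g j ⟩
    (countWith G a ⋆ countWithout H b) j        ≡⟨ ⋆-congˡ withG _ j ⟩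
    (coeff i ⋆ countWithout H b) j              ≡⟨ ⋆-congʳ (coeff i) withoutH j ⟩
    (coeff i ⋆ coeff (proj₁ h)) j               ≡⟨ coeff-⊗ i (proj₁ h) j ⟨
    coeff (i ⊗ proj₁ h) j                       ∎)

vertexPolys : Poly × Poly
vertexPolys = (1 ∷ [] , 0 ∷ 1 ∷ [])

vertex-rootPolys : HasRootPolys (mkGraph 1 []) 0 vertexPolys
vertex-rootPolys = without , with′
  where
  without : countWithout (mkGraph 1 []) 0 ≗ coeff (1 ∷ [])
  without zero    = refl
  without (suc j) = refl
  with′ : countWith (mkGraph 1 []) 0 ≗ coeff (0 ∷ 1 ∷ [])
  with′ zero          = refl
  with′ (suc zero)    = refl
  with′ (suc (suc j)) = refl

ZPolys : Poly × Poly → ℕ → Poly × Poly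
ZPolys h zero    = vertexPolys
ZPolys h (suc k) = bridgePolys (ZPolys h k) h

gluePolys : Poly × Poly → Poly × Poly → ℕ → Poly × Poly
gluePolys g h k = bridgePolys g (ZPolys h k)

glueIterPolys : Poly × Poly → Poly × Poly → ℕ → ℕ → Poly × Poly
glueIterPolys g h k zero    = g
glueIterPolys g h k (suc m) = gluePolys (glueIterPolys g h k m) h k

Z-rootPolys : ∀ H h k → WellFormed H → HasRootPolys (graph H) (root H) h → HasRootPolys (graph (Z H k)) 0 (ZPolys h k)
Z-rootPolys H h zero    wfH polysH = vertex-rootPolys
Z-rootPolys H h (suc k) wfH polysH =
  subst (λ X → HasRootPolys X 0 (ZPolys h (suc k))) (sym (Z-suc-bridge H k))
    (bridge-rootPolys (graph (Z H k)) (graph H) (ZPolys h k) h (Z-valid H k wfH) (s≤s z≤n) (Z-rootPolys H h k wfH polysH) polysH)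

glue-rootPolys : ∀ G H g h k → WellFormed G → WellFormed H →
  HasRootPolys (graph G) (root G) g → HasRootPolys (graph H) (root H) h → HasRootPolys (graph (glue G H k)) (root G) (gluePolys g h k)
glue-rootPolys G H g h k (validG , r<g) wfH polysG polysH =
  subst (λ X → HasRootPolys X (root G) (gluePolys g h k)) (sym (glue-bridge G H k))
    (bridge-rootPolys (graph G) (graph (Z H k)) g (ZPolys h k) validG r<g polysG (Z-rootPolys H h k wfH polysH))

glueIter-rootPolys : ∀ G H g h k m → WellFormed G → WellFormed H →
  HasRootPolys (graph G) (root G) g → HasRootPolys (graph H) (root H) h →
  HasRootPolys (graph (glueIter G H k m)) (root (glueIter G H k m)) (glueIterPolys g h k m)
glueIter-rootPolys G H g h k zero    wfG wfH polysG polysH = polysG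
glueIter-rootPolys G H g h k (suc m) wfG wfH polysG polysH =
  glue-rootPolys (glueIter G H k m) H (glueIterPolys g h k m) h k (glueIter-wellFormed G H k m wfG wfH) wfH
    (glueIter-rootPolys G H g h k m wfG wfH polysG polysH) polysH

-- Binomial forms and the top coefficients

choose : ℕ → ℕ → ℕ
choose n       zero    = 1
choose zero    (suc k) = 0
choose (suc n) (suc k) = choose n k + choose n (suc k)

evalBinomialFrom : ℕ → Poly → ℕ → ℕ
evalBinomialFrom k []       m = 0
evalBinomialFrom k (c ∷ cs) m = c * choose m k + evalBinomialFrom (suc k) cs m

evalBinomial : Poly → ℕ → ℕ
evalBinomial = evalBinomialFrom 0

evalBinomialFrom-⊕ : ∀ k c d m → evalBinomialFrom k (c ⊕ d) m ≡ evalBinomialFrom k c m + evalBinomialFrom k d m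
evalBinomialFrom-⊕ k []      d       m = refl
evalBinomialFrom-⊕ k (a ∷ c) []      m = sym (+-identityʳ _)
evalBinomialFrom-⊕ k (a ∷ c) (b ∷ d) m = begin
  (a + b) * choose m k + evalBinomialFrom (suc k) (c ⊕ d) m
    ≡⟨ cong ((a + b) * choose m k +_) (evalBinomialFrom-⊕ (suc k) c d m) ⟩
  (a + b) * choose m k + (evalBinomialFrom (suc k) c m + evalBinomialFrom (suc k) d m)
    ≡⟨ lemma a b (choose m k) _ _ ⟩
  (a * choose m k + evalBinomialFrom (suc k) c m) + (b * choose m k + evalBinomialFrom (suc k) d m) ∎
  where
  lemma : ∀ a b x u v → (a + b) * x + (u + v) ≡ (a * x + u) + (b * x + v)
  lemma = solve-∀

evalBinomialFrom-scale : ∀ k a c m → evalBinomialFrom k (map (_* a) c) m ≡ evalBinomialFrom k c m * a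
evalBinomialFrom-scale k a []      m = refl
evalBinomialFrom-scale k a (b ∷ c) m = begin
  b * a * choose m k + evalBinomialFrom (suc k) (map (_* a) c) m
    ≡⟨ cong (b * a * choose m k +_) (evalBinomialFrom-scale (suc k) a c m) ⟩
  b * a * choose m k + evalBinomialFrom (suc k) c m * a
    ≡⟨ lemma a b (choose m k) _ ⟩
  (b * choose m k + evalBinomialFrom (suc k) c m) * a ∎
  where
  lemma : ∀ a b x u → b * a * x + u * a ≡ (b * x + u) * a
  lemma = solve-∀

evalBinomialFrom-suc : ∀ k c m →
  evalBinomialFrom (suc k) c (suc m) ≡ evalBinomialFrom (suc k) c m + evalBinomialFrom k c m
evalBinomialFrom-suc k []      m = refl
evalBinomialFrom-suc k (a ∷ c) m = begin
  a * (choose m k + choose m (suc k)) + evalBinomialFrom (2 + k) c (suc m)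
    ≡⟨ cong (a * (choose m k + choose m (suc k)) +_) (evalBinomialFrom-suc (suc k) c m) ⟩
  a * (choose m k + choose m (suc k)) + (evalBinomialFrom (2 + k) c m + evalBinomialFrom (suc k) c m)
    ≡⟨ lemma a (choose m k) (choose m (suc k)) _ _ ⟩
  (a * choose m (suc k) + evalBinomialFrom (2 + k) c m) + (a * choose m k + evalBinomialFrom (suc k) c m) ∎
  where
  lemma : ∀ a x y u v → a * (x + y) + (u + v) ≡ (a * y + u) + (a * x + v)
  lemma = solve-∀

pascal : Poly → Poly
pascal c = c ⊕ drop 1 c

evalBinomial-pascal : ∀ c m → evalBinomial (pascal c) m ≡ evalBinomial c (suc m)
evalBinomial-pascal []      m = refl
evalBinomial-pascal (a ∷ c) m = begin
  evalBinomial ((a ∷ c) ⊕ c) m                                   ≡⟨ evalBinomialFrom-⊕ 0 (a ∷ c) c m ⟩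
  (a * 1 + evalBinomialFrom 1 c m) + evalBinomial c m            ≡⟨ +-assoc (a * 1) _ _ ⟩
  a * 1 + (evalBinomialFrom 1 c m + evalBinomial c m)            ≡⟨ cong (a * 1 +_) (evalBinomialFrom-suc 0 c m) ⟨
  evalBinomial (a ∷ c) (suc m)                                   ∎

-- Polynomials in x whose coefficients are binomial forms in m.
open CoefficientLists {Poly} _⊕_ (λ c a → map (_* a) c) [] using () renaming (_⊕_ to _⊕ᴿ_; _⊗_ to _⊗ᴿ_)

evalRows : List Poly → ℕ → Poly
evalRows R m = map (λ c → evalBinomial c m) R

evalRows-⊕ : ∀ R S m → evalRows (R ⊕ᴿ S) m ≡ evalRows R m ⊕ evalRows S m
evalRows-⊕ []      S       m = refl
evalRows-⊕ (c ∷ R) []      m = refl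
evalRows-⊕ (c ∷ R) (d ∷ S) m = cong₂ _∷_ (evalBinomialFrom-⊕ 0 c d m) (evalRows-⊕ R S m)

evalRows-⊗ : ∀ R q m → evalRows (R ⊗ᴿ q) m ≡ evalRows R m ⊗ q
evalRows-⊗ R []      m = refl
evalRows-⊗ R (a ∷ q) m = begin
  evalRows (map (λ c → map (_* a) c) R ⊕ᴿ ([] ∷ R ⊗ᴿ q)) m
    ≡⟨ evalRows-⊕ (map (λ c → map (_* a) c) R) _ m ⟩
  evalRows (map (λ c → map (_* a) c) R) m ⊕ (0 ∷ evalRows (R ⊗ᴿ q) m)
    ≡⟨ cong₂ (λ u v → u ⊕ (0 ∷ v)) scaled (evalRows-⊗ R q m) ⟩
  map (_* a) (evalRows R m) ⊕ (0 ∷ evalRows R m ⊗ q) ∎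
  where
  scaled : evalRows (map (λ c → map (_* a) c) R) m ≡ map (_* a) (evalRows R m)
  scaled = trans (sym (map-∘ R)) (trans (map-cong (λ c → evalBinomialFrom-scale 0 a c m) R) (map-∘ R))

evalRows-pascal : ∀ R m → evalRows (map pascal R) m ≡ evalRows R (suc m)
evalRows-pascal R m = trans (sym (map-∘ R)) (map-cong (λ c → evalBinomial-pascal c m) R)

⋆-single : ∀ f a i → (f ⋆ coeff (a ∷ [])) i ≡ f i * a
⋆-single f a zero    = refl
⋆-single f a (suc i) = trans (cong (f (suc i) * a +_) (⋆-zeroʳ f i)) (+-identityʳ _)

⋆-tail : ∀ f z e k → length z ≤ suc k → (f ⋆ coeff z) (k + e) ≡ ((λ s → f (s + e)) ⋆ coeff z) k
⋆-tail f []           e k       _         = trans (⋆-zeroʳ f (k + e)) (sym (⋆-zeroʳ _ k))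
⋆-tail f (a ∷ [])     e zero    _         = ⋆-single f a e
⋆-tail f (a ∷ b ∷ z)  e zero    (s≤s ())
⋆-tail f (a ∷ z)      e (suc k) (s≤s |z|≤k) = cong (f (suc k + e) * a +_) (⋆-tail f z e k |z|≤k)

-- Multiplying by z of degree d raises the top window by d and acts on it linearly; the hypothesis on R
-- says that on binomial coordinates this action is Pascal's rule, i.e. the passage from m to m + 1.
topCoefficients : ∀ (p : ℕ → Poly) z d e R →
  (∀ m → p (suc m) ≡ p m ⊗ z) → length z ≤ suc d → drop d (R ⊗ᴿ z) ≡ map pascal R →
  (∀ t → coeff (p 0) (t + e) ≡ coeff (evalRows R 0) t) →
  ∀ m t → coeff (p m) (t + (m * d + e)) ≡ coeff (evalRows R m) t
topCoefficients p z d e R step deg rows base zero    t = base t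
topCoefficients p z d e R step deg rows base (suc m) t = begin
  coeff (p (suc m)) (t + (suc m * d + e))
    ≡⟨ cong₂ coeff (step m) (index t d (m * d) e) ⟩
  coeff (p m ⊗ z) ((d + t) + E)
    ≡⟨ coeff-⊗ (p m) z _ ⟩
  (coeff (p m) ⋆ coeff z) ((d + t) + E)
    ≡⟨ ⋆-tail (coeff (p m)) z E (d + t) (≤-trans deg (s≤s (m≤m+n d t))) ⟩
  ((λ s → coeff (p m) (s + E)) ⋆ coeff z) (d + t)
    ≡⟨ ⋆-congˡ (topCoefficients p z d e R step deg rows base m) (coeff z) (d + t) ⟩
  (coeff (evalRows R m) ⋆ coeff z) (d + t)
    ≡⟨ coeff-⊗ (evalRows R m) z (d + t) ⟨
  coeff (evalRows R m ⊗ z) (d + t)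
    ≡⟨ cong (λ q → coeff q (d + t)) (evalRows-⊗ R z m) ⟨
  coeff (evalRows (R ⊗ᴿ z) m) (d + t)
    ≡⟨ coeff-drop d _ t ⟩
  coeff (drop d (evalRows (R ⊗ᴿ z) m)) t
    ≡⟨ cong (λ q → coeff q t) (drop-map d (R ⊗ᴿ z)) ⟩
  coeff (evalRows (drop d (R ⊗ᴿ z)) m) t
    ≡⟨ cong (λ R′ → coeff (evalRows R′ m) t) rows ⟩
  coeff (evalRows (map pascal R) m) t
    ≡⟨ cong (λ q → coeff q t) (evalRows-pascal R m) ⟩
  coeff (evalRows R (suc m)) t ∎
  where
  E = m * d + e
  index : ∀ t d x e → t + ((d + x) + e) ≡ (d + t) + (x + e)
  index = solve-∀

-- Binomial forms at s + n as polynomials in n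

choose-absorption : ∀ m k → suc k * choose (suc m) (suc k) ≡ suc m * choose m k
choose-absorption zero    zero    = refl
choose-absorption zero    (suc k) = *-zeroʳ (suc (suc k))
choose-absorption (suc m) zero    = begin
  1 * (1 + choose (suc m) 1)   ≡⟨ *-identityˡ _ ⟩
  1 + choose (suc m) 1         ≡⟨ cong suc (trans (sym (*-identityˡ _)) (choose-absorption m 0)) ⟩
  suc (suc m) * 1              ∎
choose-absorption (suc m) (suc k) = begin
  suc (suc k) * (C + choose (suc m) (suc (suc k)))             ≡⟨ *-distribˡ-+ (suc (suc k)) C _ ⟩
  (C + suc k * C) + suc (suc k) * choose (suc m) (suc (suc k)) ≡⟨ cong₂ (λ u v → (C + u) + v) (choose-absorption m k) (choose-absorption m (suc k)) ⟩
  (C + suc m * choose m k) + suc m * choose m (suc k)          ≡⟨ +-assoc C _ _ ⟩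
  C + (suc m * choose m k + suc m * choose m (suc k))          ≡⟨ cong (C +_) (*-distribˡ-+ (suc m) (choose m k) _) ⟨
  suc (suc m) * C                                              ∎
  where C = choose (suc m) (suc k)

falling : ℕ → ℕ → Poly
falling s zero    = 1 ∷ []
falling s (suc k) = (s ∷ 1 ∷ []) ⊗ falling (s ∸ 1) k

eval-falling : ∀ s k n → k ≤ s → eval (falling s k) n ≡ k ! * choose (s + n) k
eval-falling s       zero    n _         = cong (1 +_) (*-zeroʳ n)
eval-falling (suc s) (suc k) n (s≤s k≤s) = begin
  eval ((suc s ∷ 1 ∷ []) ⊗ falling s k) n                ≡⟨ eval-⊗ (suc s ∷ 1 ∷ []) (falling s k) n ⟩
  eval (suc s ∷ 1 ∷ []) n * eval (falling s k) n         ≡⟨ cong₂ _*_ (linear (suc s) n) (eval-falling s k n k≤s) ⟩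
  suc (s + n) * (k ! * choose (s + n) k)                 ≡⟨ swap (suc (s + n)) (k !) _ ⟩
  k ! * (suc (s + n) * choose (s + n) k)                 ≡⟨ cong (k ! *_) (choose-absorption (s + n) k) ⟨
  k ! * (suc k * choose (suc (s + n)) (suc k))           ≡⟨ swap (k !) (suc k) _ ⟩
  suc k * (k ! * choose (suc (s + n)) (suc k))           ≡⟨ *-assoc (suc k) (k !) _ ⟨
  suc k * k ! * choose (suc (s + n)) (suc k)             ∎
  where
  linear : ∀ a x → a + x * (1 + x * 0) ≡ a + x
  linear = solve-∀
  swap : ∀ x y z → x * (y * z) ≡ y * (x * z)
  swap = solve-∀

evalFallingFrom : ℕ → Poly → ℕ → ℕ
evalFallingFrom k []       m = 0
evalFallingFrom k (c ∷ cs) m = c * (k ! * choose m k) + evalFallingFrom (suc k) cs m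

fallingSum : ℕ → ℕ → Poly → Poly
fallingSum s k []       = []
fallingSum s k (c ∷ cs) = map (_* c) (falling s k) ⊕ fallingSum s (suc k) cs

eval-fallingSum : ∀ s k c n → k + length c ≤ suc s → eval (fallingSum s k c) n ≡ evalFallingFrom k c (s + n)
eval-fallingSum s k []       n _   = refl
eval-fallingSum s k (c ∷ cs) n fit = begin
  eval (map (_* c) (falling s k) ⊕ fallingSum s (suc k) cs) n
    ≡⟨ eval-⊕ (map (_* c) (falling s k)) _ n ⟩
  eval (map (_* c) (falling s k)) n + eval (fallingSum s (suc k) cs) n
    ≡⟨ cong₂ _+_ (eval-scale c (falling s k) n) (eval-fallingSum s (suc k) cs n (subst (_≤ suc s) (+-suc k (length cs)) fit)) ⟩
  eval (falling s k) n * c + evalFallingFrom (suc k) cs (s + n)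
    ≡⟨ cong (_+ evalFallingFrom (suc k) cs (s + n)) (trans (cong (_* c) (eval-falling s k n k≤s)) (*-comm _ c)) ⟩
  c * (k ! * choose (s + n) k) + evalFallingFrom (suc k) cs (s + n) ∎
  where
  k≤s : k ≤ s
  k≤s = ≤-pred (≤-trans (s≤s (m≤m+n k (length cs))) (subst (_≤ suc s) (+-suc k (length cs)) fit))

-- The weights are 4!/k!: multiplying by 4! clears the denominators of C(s + n, k) as a polynomial in n.
shifted : ℕ → Vec ℕ 5 → Poly
shifted s (c₀ ∷ c₁ ∷ c₂ ∷ c₃ ∷ c₄ ∷ []) = fallingSum s 0 (24 * c₀ ∷ 24 * c₁ ∷ 12 * c₂ ∷ 4 * c₃ ∷ c₄ ∷ [])

eval-shifted : ∀ s c n → 4 ≤ s → eval (shifted s c) n ≡ 24 * evalBinomial (toList c) (s + n)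
eval-shifted s (c₀ ∷ c₁ ∷ c₂ ∷ c₃ ∷ c₄ ∷ []) n 4≤s =
  trans (eval-fallingSum s 0 (24 * c₀ ∷ 24 * c₁ ∷ 12 * c₂ ∷ 4 * c₃ ∷ c₄ ∷ []) n (s≤s 4≤s))
        (weights c₀ c₁ c₂ c₃ c₄ (choose (s + n) 1) (choose (s + n) 2) (choose (s + n) 3) (choose (s + n) 4))
  where
  weights : ∀ c₀ c₁ c₂ c₃ c₄ x₁ x₂ x₃ x₄ →
    24 * c₀ * 1 + (24 * c₁ * (1 * x₁) + (12 * c₂ * (2 * x₂) + (4 * c₃ * (6 * x₃) + (c₄ * (24 * x₄) + 0))))
      ≡ 24 * (c₀ * 1 + (c₁ * x₁ + (c₂ * x₂ + (c₃ * x₃ + (c₄ * x₄ + 0)))))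
  weights = solve-∀

infix 4 _≤ᶜ_ _<ᶜ_

_≤ᶜ_ : Poly → Poly → Bool
[]      ≤ᶜ q       = true
(a ∷ p) ≤ᶜ []      = false
(a ∷ p) ≤ᶜ (b ∷ q) = (a ≤ᵇ b) ∧ (p ≤ᶜ q)

_<ᶜ_ : Poly → Poly → Bool
[]      <ᶜ q       = false
(a ∷ p) <ᶜ []      = false
(a ∷ p) <ᶜ (b ∷ q) = (a <ᵇ b) ∧ (p ≤ᶜ q)

eval-mono : ∀ p q x → T (p ≤ᶜ q) → eval p x ≤ eval q x
eval-mono []      q       x _ = z≤n
eval-mono (a ∷ p) (b ∷ q) x h with Equivalence.to T-∧ h
... | a≤b , p≤q = +-mono-≤ (≤ᵇ⇒≤ a b a≤b) (*-monoʳ-≤ x (eval-mono p q x p≤q))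

eval-strictMono : ∀ p q x → T (p <ᶜ q) → eval p x < eval q x
eval-strictMono (a ∷ p) (b ∷ q) x h with Equivalence.to T-∧ h
... | a<b , p≤q = +-mono-<-≤ (<ᵇ⇒< a b a<b) (*-monoʳ-≤ x (eval-mono p q x p≤q))

squareLessThanProduct : ∀ s (u v w : Vec ℕ 5) → 4 ≤ s →
  T (shifted s v ⊗ shifted s v <ᶜ shifted s u ⊗ shifted s w) →
  ∀ n → let at c = evalBinomial (toList c) (s + n) in at v * at v < at u * at w
squareLessThanProduct s u v w 4≤s check n =
  *-cancelˡ-< 576 _ _ (subst₂ _<_ (scaled v v) (scaled u w) (eval-strictMono (shifted s v ⊗ shifted s v) (shifted s u ⊗ shifted s w) n check))
  where
  scaled : ∀ x y → eval (shifted s x ⊗ shifted s y) n ≡ 576 * (evalBinomial (toList x) (s + n) * evalBinomial (toList y) (s + n))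
  scaled x y = begin
    eval (shifted s x ⊗ shifted s y) n
      ≡⟨ eval-⊗ (shifted s x) (shifted s y) n ⟩
    eval (shifted s x) n * eval (shifted s y) n
      ≡⟨ cong₂ _*_ (eval-shifted s x n 4≤s) (eval-shifted s y n 4≤s) ⟩
    24 * evalBinomial (toList x) (s + n) * (24 * evalBinomial (toList y) (s + n))
      ≡⟨ lemma (evalBinomial (toList x) (s + n)) _ ⟩
    576 * (evalBinomial (toList x) (s + n) * evalBinomial (toList y) (s + n)) ∎
    where
    lemma : ∀ a b → 24 * a * (24 * b) ≡ 576 * (a * b)
    lemma = solve-∀

-- The tree (T₁,₇ : S₂,₅)₂⁽ᵐ⁾

asRows : List (Vec ℕ 5) → List Poly
asRows = map toList

rowAt : List (Vec ℕ 5) → ℕ → Vec ℕ 5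
rowAt []      t       = 0 ∷ 0 ∷ 0 ∷ 0 ∷ 0 ∷ []
rowAt (v ∷ V) zero    = v
rowAt (v ∷ V) (suc t) = rowAt V t

coeff-evalRows : ∀ V m t → coeff (evalRows (asRows V) m) t ≡ evalBinomial (toList (rowAt V t)) m
coeff-evalRows []      m t       = refl
coeff-evalRows (v ∷ V) m zero    = refl
coeff-evalRows (v ∷ V) m (suc t) = coeff-evalRows V m t

edgePolys : Poly × Poly
edgePolys = (1 ∷ 1 ∷ [] , 0 ∷ 1 ∷ [])

edge-rootPolys : HasRootPolys (graph P₂) 0 edgePolys
edge-rootPolys = without , with′
  where
  without : countWithout (graph P₂) 0 ≗ coeff (1 ∷ 1 ∷ [])
  without zero          = refl
  without (suc zero)    = refl
  without (suc (suc j)) = refl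
  with′ : countWith (graph P₂) 0 ≗ coeff (0 ∷ 1 ∷ [])
  with′ zero          = refl
  with′ (suc zero)    = refl
  with′ (suc (suc j)) = refl

P₁-wellFormed : WellFormed P₁
P₁-wellFormed = [] , s≤s z≤n

P₂-wellFormed : WellFormed P₂
P₂-wellFormed = ((s≤s z≤n , s≤s (s≤s z≤n)) ∷ []) , s≤s z≤n

T-polys S-polys : Poly × Poly
T-polys = gluePolys vertexPolys edgePolys 7
S-polys = glueIterPolys vertexPolys vertexPolys 1 5

tree : ℕ → RGraph
tree m = glueIter (T₁ 7) (S₂ 5) 2 m

treePolys : ℕ → Poly × Poly
treePolys m = glueIterPolys T-polys S-polys 2 m

tree-rootPolys : ∀ m → HasRootPolys (graph (tree m)) (root (tree m)) (treePolys m)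
tree-rootPolys m = glueIter-rootPolys (T₁ 7) (S₂ 5) T-polys S-polys 2 m
  (glue-wellFormed P₁ P₂ 7 P₁-wellFormed P₂-wellFormed)
  (glueIter-wellFormed P₁ P₁ 1 5 P₁-wellFormed P₁-wellFormed)
  (glue-rootPolys P₁ P₂ vertexPolys edgePolys 7 P₁-wellFormed P₂-wellFormed vertex-rootPolys edge-rootPolys)
  (glueIter-rootPolys P₁ P₁ vertexPolys vertexPolys 1 5 P₁-wellFormed P₁-wellFormed vertex-rootPolys vertex-rootPolys)

-- Row t gives the coefficient of x^(12m + 4 + t) of the root-avoiding (resp. root-containing) part
-- of I(tree m; x) in the basis C(m, 0), …, C(m, 4).
rowsWithout rowsWith : List (Vec ℕ 5)
rowsWithout =
  (595 ∷ 6412857 ∷ 2627314137 ∷ 202827200148 ∷ 1453481004816 ∷ []) ∷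
  (707 ∷ 1433637 ∷ 177401664 ∷ 1323753192 ∷ 0 ∷ []) ∷
  (469 ∷ 154899 ∷ 1205604 ∷ 0 ∷ 0 ∷ []) ∷
  (135 ∷ 1098 ∷ 0 ∷ 0 ∷ 0 ∷ []) ∷
  (1 ∷ 0 ∷ 0 ∷ 0 ∷ 0 ∷ []) ∷ []
rowsWith =
  (280 ∷ 6047488 ∷ 543085056 ∷ 3438752768 ∷ 3838281728 ∷ []) ∷
  (560 ∷ 1619200 ∷ 31797504 ∷ 51868672 ∷ 0 ∷ []) ∷
  (672 ∷ 231424 ∷ 700928 ∷ 0 ∷ 0 ∷ []) ∷
  (448 ∷ 9472 ∷ 0 ∷ 0 ∷ 0 ∷ []) ∷
  (128 ∷ 0 ∷ 0 ∷ 0 ∷ 0 ∷ []) ∷ []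

topRow : ℕ → Vec ℕ 5
topRow = rowAt (zipWith (Vec.zipWith _+_) rowsWithout rowsWith)

topValue : ℕ → ℕ → ℕ
topValue m t = evalBinomial (toList (topRow t)) m

tree-topWithout : ∀ m t → coeff (proj₁ (treePolys m)) (t + (m * 12 + 4)) ≡ coeff (evalRows (asRows rowsWithout) m) t
tree-topWithout = topCoefficients (proj₁ ∘ treePolys) (total (ZPolys S-polys 2)) 12 4 (asRows rowsWithout)
  (λ _ → refl) ≤-refl refl (λ t → cong (coeff (proj₁ T-polys)) (+-comm t 4))

tree-topWith : ∀ m t → coeff (proj₂ (treePolys m)) (t + (m * 12 + 4)) ≡ coeff (evalRows (asRows rowsWith) m) t
tree-topWith = topCoefficients (proj₂ ∘ treePolys) (proj₁ (ZPolys S-polys 2)) 12 4 (asRows rowsWith)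
  (λ _ → refl) ≤-refl refl (λ t → cong (coeff (proj₂ T-polys)) (+-comm t 4))

topCount : ∀ m t → indepCount (graph (tree m)) (t + (m * 12 + 4)) ≡ topValue m t
topCount m t = begin
  indepCount (graph (tree m)) j
    ≡⟨ indepCount-total {graph (tree m)} {root (tree m)} (treePolys m) (tree-rootPolys m) j ⟩
  coeff (proj₁ (treePolys m) ⊕ proj₂ (treePolys m)) j
    ≡⟨ coeff-⊕ (proj₁ (treePolys m)) (proj₂ (treePolys m)) j ⟩
  coeff (proj₁ (treePolys m)) j + coeff (proj₂ (treePolys m)) j
    ≡⟨ cong₂ _+_ (tree-topWithout m t) (tree-topWith m t) ⟩
  coeff (evalRows (asRows rowsWithout) m) t + coeff (evalRows (asRows rowsWith) m) t
    ≡⟨ coeff-⊕ (evalRows (asRows rowsWithout) m) (evalRows (asRows rowsWith) m) t ⟨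
  coeff (evalRows (asRows rowsWithout) m ⊕ evalRows (asRows rowsWith) m) t
    ≡⟨ cong (λ p → coeff p t) (evalRows-⊕ (asRows rowsWithout) (asRows rowsWith) m) ⟨
  coeff (evalRows (asRows (zipWith (Vec.zipWith _+_) rowsWithout rowsWith)) m) t
    ≡⟨ coeff-evalRows (zipWith (Vec.zipWith _+_) rowsWithout rowsWith) m t ⟩
  topValue m t ∎
  where
  j = t + (m * 12 + 4)

topIndex : ∀ m t → t + (m * 12 + 4) ≡ 12 * m + (4 + t)
topIndex = solve-∀

-- topValue m 4 computes to 129, and topValue m (5 + j) to 0.
tree-degree : ∀ m → HasDegree (graph (tree m)) (12 * m + 8)
tree-degree m = (λ eq → 1+n≢0 (trans (sym count₄) eq)) , vanishing
  where
  count₄ : indepCount (graph (tree m)) (12 * m + 8) ≡ topValue m 4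
  count₄ = subst (λ i → indepCount (graph (tree m)) i ≡ topValue m 4) (topIndex m 4) (topCount m 4)
  vanishing : ∀ i → 12 * m + 8 < i → indepCount (graph (tree m)) i ≡ 0
  vanishing i 12m+8<i = subst (λ i → indepCount (graph (tree m)) i ≡ 0) index (topCount m (5 + j))
    where
    j = i ∸ suc (12 * m + 8)
    index : 5 + j + (m * 12 + 4) ≡ i
    index = trans (reorder m j) (m+[n∸m]≡n 12m+8<i)
      where
      reorder : ∀ m j → 5 + j + (m * 12 + 4) ≡ suc (12 * m + 8) + j
      reorder = solve-∀

tree-logConcavityBroken : ∀ m t → topValue m (suc t) * topValue m (suc t) < topValue m t * topValue m (2 + t) →
  LCBrokenAt (graph (tree m)) (12 * m + (5 + t))
tree-logConcavityBroken m t fails = subst (LCBrokenAt (graph (tree m))) (topIndex m (suc t))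
  (subst₂ _<_ (sym (cong₂ _*_ (topCount m (suc t)) (topCount m (suc t))))
              (sym (cong₂ _*_ (topCount m t) (topCount m (2 + t)))) fails)

topValue-logConcavityFails : ∀ m t → 13 ≤ m →
  T (shifted 13 (topRow (suc t)) ⊗ shifted 13 (topRow (suc t)) <ᶜ shifted 13 (topRow t) ⊗ shifted 13 (topRow (2 + t))) →
  topValue m (suc t) * topValue m (suc t) < topValue m t * topValue m (2 + t)
topValue-logConcavityFails m t 13≤m check =
  subst (λ m → topValue m (suc t) * topValue m (suc t) < topValue m t * topValue m (2 + t)) (m+[n∸m]≡n 13≤m)
    (squareLessThanProduct 13 (topRow t) (topRow (suc t)) (topRow (2 + t)) (≤ᵇ⇒≤ 4 13 tt) check (m ∸ 13))

corollary4p14 : ∀ (m : ℕ) → 13 ≤ m →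
    let G = graph (glueIter (T₁ 7) (S₂ 5) 2 m) in
    HasDegree G (12 * m + 8) × LCBrokenAt G (12 * m + 7) × LCBrokenAt G (12 * m + 6) × LCBrokenAt G (12 * m + 5)
corollary4p14 m 13≤m =
  tree-degree m ,
  tree-logConcavityBroken m 2 (topValue-logConcavityFails m 2 13≤m tt) ,
  tree-logConcavityBroken m 1 (topValue-logConcavityFails m 1 13≤m tt) ,
  tree-logConcavityBroken m 0 (topValue-logConcavityFails m 0 13≤m tt)
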